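{- Let $k\ge 3$. The complete $k$-partite graph $K_{2,4,6*(k-2)}$, with one part of size $2$, one part of size $4$, and $k-2$ parts of size $6$, is strictly $k$-colorable.
   Context: Graphs are finite and simple. An integer partition $\lambda$ of a positive integer $k$ is a multiset of positive integers summing to $k$; $a*b$ denotes $b$ copies of $a$. A $k$-assignment $L$ of $G$ assigns to each vertex $v$ a set $L(v)$ of $k$ colors; $G$ is $L$-colorable if there is a proper coloring with each vertex $v$ receiving a color from $L(v)$. For an integer partition $\lambda=\{k_1,\dots,k_t\}$ of $k$, a $\lambda$-assignment of $G$ is a $k$-assignment $L$ such that $\bigcup_{v}L(v)$ can be partitioned into sets $C_1,\dots,C_t$ with $|L(v)\cap C_i|=k_i$ for every vertex $v$ and every $i$. $G$ is $\lambda$-choosable if $G$ is $L$-colorable for every $\lambda$-assignment $L$. (It is known that $G$ is $\{1*k\}$-choosable iff $G$ is $k$-colorable.) A graph $G$ is strictly $k$-colorable if $\{1*k\}$ is the only integer partition $\lambda$ of $k$ for which $G$ is $\lambda$-choosable, i.e. $G$ is $\{1*k\}$-choosable and not $\lambda$-choosable for any other partition $\lambda$ of $k$. -}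

module Defs where

open import Data.Nat using (ℕ; _<_; _≤_)
open import Data.List using (List; length; filter; replicate; lookup; _∷_)
open import Data.List.Relation.Unary.All using (All)
open import Data.Nat.ListAction using (sum)
open import Data.List.Relation.Unary.Unique.Propositional using (Unique)
open import Data.List.Membership.Propositional using (_∈_)
open import Data.List.Relation.Binary.Permutation.Propositional using (_↭_)
open import Data.Fin using (Fin; _≟_)
open import Data.Product using (Σ; _×_; ∃; proj₁)
open import Relation.Binary.PropositionalEquality using (_≡_; _≢_)
open import Relation.Nullary using (¬_)

record Graph : Set₁ where
  field
    V   : Set
    Adj : V → V → Set

open Graph public

ListAssignment : Graph → Set
ListAssignment G = V G → List ℕ

IsKAssignment : (G : Graph) → ℕ → ListAssignment G → Set
IsKAssignment G k L = ∀ v → Unique (L v) × length (L v) ≡ k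

LColorable : (G : Graph) → ListAssignment G → Set
LColorable G L = Σ (V G → ℕ) λ c →
  (∀ v → c v ∈ L v) × (∀ u v → Adj G u v → c u ≢ c v)

-- Integer partition of k: a list (order irrelevant, read as multiset) of positive integers summing to k.
IsPartition : ℕ → List ℕ → Set
IsPartition k λs = All (λ x → 0 < x) λs × sum λs ≡ k

-- λ-assignment: a k-assignment together with a partition of the colors into classes
-- C_1..C_t (given by a class function on colors) with |L(v) ∩ C_i| = k_i.
IsLambdaAssignment : (G : Graph) → (k : ℕ) → (λs : List ℕ) → ListAssignment G → Set
IsLambdaAssignment G k λs L =
  IsKAssignment G k L ×
  ∃ λ (cls : ℕ → Fin (length λs)) →
    ∀ v i → length (filter (λ c → cls c ≟ i) (L v)) ≡ lookup λs i

LambdaChoosable : Graph → ℕ → List ℕ → Set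
LambdaChoosable G k λs = ∀ (L : ListAssignment G) → IsLambdaAssignment G k λs L → LColorable G L

StrictlyColorable : ℕ → Graph → Set
StrictlyColorable k G =
  LambdaChoosable G k (replicate k 1) ×
  (∀ λs → IsPartition k λs → ¬ (λs ↭ replicate k 1) → ¬ LambdaChoosable G k λs)

CompleteMultipartite : List ℕ → Graph
CompleteMultipartite sizes = record
  { V   = Σ (Fin (length sizes)) (λ i → Fin (lookup sizes i))
  ; Adj = λ u v → proj₁ u ≢ proj₁ v
  }

-- Give the part of size 2 the colour pairs {0,1}, {2,3}, the part of size 4 the four pairs
-- crossing {0,1} | {2,3}, and every part of size 6 all six pairs from {0,1,2,3}; add to every
-- list the same palette Z of k − 2 further colours. If λ ≠ {1*k}, some class has size ≥ 2,
-- so the colours 0,…,3 can be put into it and Z distributed to fill up all classes: this is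
-- a λ-assignment. In a colouring from it, distinct parts using a colour of Z use distinct
-- colours, so two of the k parts avoid Z and are coloured from their pairs. But such colour
-- sets of two distinct parts always meet: a set hitting all six pairs has three elements,
-- one hitting the crossing pairs contains {0,1} or {2,3}, and one hitting {0,1} and {2,3}
-- contains a crossing pair. Conversely, for λ = {1*k} colour part i from class i.
module Submission where

open import Defs
open import Data.Nat using (ℕ; zero; suc; _+_; _∸_; _<_; _≤_; z≤n; s≤s; _<?_; _≤?_; _≟_)
open import Data.Nat.Properties
  using (≤-reflexive; ≤-trans; ≤-pred; n≤1+n; m≤m+n; <-≤-trans; <⇒≢; ≰⇒>; +-cancelˡ-≡; m+[n∸m]≡n)
open import Data.Nat.ListAction using (sum)
open import Data.List using (List; []; _∷_; _++_; [_]; replicate; length; lookup; tabulate; map; filter)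
open import Data.List.Properties
  using (length-replicate; lookup-replicate; length-++; length-map; length-tabulate; map-tabulate; filter-accept)
open import Data.List.Relation.Unary.All using (All; []; _∷_)
import Data.List.Relation.Unary.All.Properties as All
open import Data.List.Relation.Unary.AllPairs using (_∷_)
open import Data.List.Relation.Unary.Any using (here; there; index)
open import Data.List.Relation.Unary.Any.Properties using (lookup-index)
open import Data.List.Relation.Unary.Unique.Propositional using (Unique)
import Data.List.Relation.Unary.Unique.Propositional.Properties as Unique
open import Data.List.Membership.Propositional using (_∈_; _∉_)
open import Data.List.Membership.Propositional.Properties using (∈-filter⁻; ∈-∃++)
open import Data.List.Membership.DecPropositional _≟_ using (_∈?_)
open import Data.List.Relation.Binary.Permutation.Propositional using (_↭_; ↭-refl; ↭-reflexive; ↭-trans; prep)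
open import Data.List.Relation.Binary.Permutation.Propositional.Properties using (↭-length; filter-↭; shift)
open import Data.Fin as Fin using (Fin; toℕ; cast)
open import Data.Fin.Patterns using (0F; 1F; 2F; 3F; 4F; 5F)
open import Data.Fin.Properties using (cast-involutive; toℕ-injective; suc-injective; pigeonhole; any?; all?)
import Data.Fin.Properties as Finₚ
open import Data.Product using (_×_; _,_; proj₁; proj₂; ∃; ∃₂)
open import Data.Sum using (_⊎_; inj₁; inj₂)
open import Function using (_∘_)
open import Relation.Nullary using (¬_; Dec; yes; no; ¬?; contradiction)
open import Relation.Nullary.Decidable using (_×-dec_; from-yes)
open import Relation.Unary using (Pred; Decidable)
open import Relation.Binary.PropositionalEquality using (_≡_; _≢_; refl; sym; trans; cong; cong₂; subst; module ≡-Reasoning)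

private
  variable
    A B : Set
    I J K : Set
    t m : ℕ

lookup-replicate′ : ∀ n (x : A) (i : Fin (length (replicate n x))) → lookup (replicate n x) i ≡ x
lookup-replicate′ n x i =
  subst (λ j → lookup (replicate n x) j ≡ x)
        (cast-involutive (sym (length-replicate n)) (length-replicate n) i)
        (lookup-replicate n x (cast (length-replicate n) i))

cast-injective : ∀ {n} .(e : m ≡ n) {i j : Fin m} → cast e i ≡ cast e j → i ≡ j
cast-injective e {i} {j} eq =
  trans (sym (cast-involutive (sym e) e i)) (trans (cong (cast (sym e)) eq) (cast-involutive (sym e) e j))

length-filter-map : ∀ {ℓ} {P : Pred B ℓ} (P? : Decidable P) (f : A → B) xs →
                    length (filter P? (map f xs)) ≡ length (filter (P? ∘ f) xs)
length-filter-map P? f [] = refl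
length-filter-map P? f (x ∷ xs) with P? (f x)
... | yes _ = cong suc (length-filter-map P? f xs)
... | no _  = length-filter-map P? f xs

filter-nonempty⇒∃ : ∀ {ℓ} {P : Pred A ℓ} (P? : Decidable P) xs → 0 < length (filter P? xs) →
                    ∃ λ x → x ∈ xs × P x
filter-nonempty⇒∃ P? xs nonempty with filter P? xs in eq
... | []    = contradiction nonempty λ ()
... | x ∷ _ = x , ∈-filter⁻ P? (subst (x ∈_) (sym eq) (here refl))

count : Fin t → List (Fin t) → ℕ
count i xs = length (filter (Fin._≟ i) xs)

count-↭ : ∀ {i : Fin t} {xs ys} → xs ↭ ys → count i xs ≡ count i ys
count-↭ {i = i} xs↭ys = ↭-length (filter-↭ (Fin._≟ i) xs↭ys)

count-∷-self : ∀ (i : Fin t) xs → count i (i ∷ xs) ≡ suc (count i xs)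
count-∷-self i xs = cong length (filter-accept (Fin._≟ i) refl)

count-shift : ∀ (x : Fin t) ys zs → count x (ys ++ [ x ] ++ zs) ≡ suc (count x (ys ++ zs))
count-shift x ys zs = trans (count-↭ (shift x ys zs)) (count-∷-self x (ys ++ zs))

↭-replicate++ : ∀ d {p : Fin t} xs → d ≤ count p xs → ∃ λ ys → xs ↭ replicate d p ++ ys
↭-replicate++ zero xs _ = xs , ↭-refl
↭-replicate++ (suc d) {p} xs d<count with filter-nonempty⇒∃ (Fin._≟ p) xs (≤-trans (s≤s z≤n) d<count)
... | x , x∈xs , refl with ∈-∃++ x∈xs
... | ys , zs , refl with ↭-replicate++ d (ys ++ zs) (≤-pred (subst (suc d ≤_) (count-shift x ys zs) d<count))
... | rest , rest↭ = rest , ↭-trans (shift x ys zs) (prep x rest↭)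

blocks : (ls : List ℕ) → List (Fin (length ls))
blocks []       = []
blocks (l ∷ ls) = replicate l 0F ++ map Fin.suc (blocks ls)

count-0F-map-suc : ∀ (xs : List (Fin t)) → count 0F (map Fin.suc xs) ≡ 0
count-0F-map-suc []       = refl
count-0F-map-suc (x ∷ xs) = count-0F-map-suc xs

count-suc-map-suc : ∀ (i : Fin t) xs → count (Fin.suc i) (map Fin.suc xs) ≡ count i xs
count-suc-map-suc i []       = refl
count-suc-map-suc i (x ∷ xs) with x Fin.≟ i
... | yes _ = cong suc (count-suc-map-suc i xs)
... | no _  = count-suc-map-suc i xs

count-0F-block : ∀ l (xs : List (Fin t)) → count 0F (replicate l 0F ++ map Fin.suc xs) ≡ l
count-0F-block zero    xs = count-0F-map-suc xs
count-0F-block (suc l) xs = cong suc (count-0F-block l xs)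

count-suc-block : ∀ (i : Fin t) l xs → count (Fin.suc i) (replicate l 0F ++ map Fin.suc xs) ≡ count i xs
count-suc-block i zero    xs = count-suc-map-suc i xs
count-suc-block i (suc l) xs = count-suc-block i l xs

count-blocks : ∀ ls i → count i (blocks ls) ≡ lookup ls i
count-blocks (l ∷ ls) 0F          = count-0F-block l (blocks ls)
count-blocks (l ∷ ls) (Fin.suc i) = trans (count-suc-block i l (blocks ls)) (count-blocks ls i)

length-blocks : ∀ ls → length (blocks ls) ≡ sum ls
length-blocks []       = refl
length-blocks (l ∷ ls) =
  trans (length-++ (replicate l 0F))
        (cong₂ _+_ (length-replicate l) (trans (length-map Fin.suc (blocks ls)) (length-blocks ls)))

lookup<2⇒ones : ∀ ls → All (0 <_) ls → (∀ i → lookup ls i < 2) → ls ≡ replicate (sum ls) 1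
lookup<2⇒ones []                []        _  = refl
lookup<2⇒ones (0 ∷ _)           (() ∷ _)  _
lookup<2⇒ones (1 ∷ ls)          (_ ∷ pos) <2 = cong (1 ∷_) (lookup<2⇒ones ls pos (<2 ∘ Fin.suc))
lookup<2⇒ones (suc (suc _) ∷ _) _         <2 with <2 0F
... | s≤s (s≤s ())

partition-part≥2 : ∀ {k ls} → IsPartition k ls → ¬ (ls ↭ replicate k 1) → ∃ λ p → 2 ≤ lookup ls p
partition-part≥2 {k} {ls} (pos , sum≡k) ≉ones with any? (λ i → 2 ≤? lookup ls i)
... | yes part = part
... | no none  = contradiction (↭-reflexive (trans ones (cong (λ n → replicate n 1) sum≡k))) ≉ones
  where
  ones : ls ≡ replicate (sum ls) 1
  ones = lookup<2⇒ones ls pos (λ i → ≰⇒> (λ 2≤ → none (i , 2≤)))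

colourable⇒ones-choosable : ∀ (G : Graph) k (col : V G → Fin k) →
                            (∀ u v → Adj G u v → col u ≢ col v) → LambdaChoosable G k (replicate k 1)
colourable⇒ones-choosable G k col proper L (_ , cls , counts) = colour , colour∈L , colour-proper
  where
  class : V G → Fin (length (replicate k 1))
  class v = cast (sym (length-replicate k)) (col v)
  choice : ∀ v → ∃ λ x → x ∈ L v × cls x ≡ class v
  choice v = filter-nonempty⇒∃ (λ x → cls x Fin.≟ class v) (L v)
               (≤-reflexive (sym (trans (counts v (class v)) (lookup-replicate k 1 (col v)))))
  colour : V G → ℕ
  colour v = proj₁ (choice v)
  colour∈L : ∀ v → colour v ∈ L v
  colour∈L v = proj₁ (proj₂ (choice v))
  colour-proper : ∀ u v → Adj G u v → colour u ≢ colour v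
  colour-proper u v adj same = proper u v adj (cast-injective (sym (length-replicate k)) same-class)
    where
    same-class : class u ≡ class v
    same-class = trans (sym (proj₂ (proj₂ (choice u)))) (trans (cong cls same) (proj₂ (proj₂ (choice v))))

multipartite-ones-choosable : ∀ sizes → LambdaChoosable (CompleteMultipartite sizes) (length sizes)
                                                        (replicate (length sizes) 1)
multipartite-ones-choosable sizes = colourable⇒ones-choosable _ _ proj₁ (λ _ _ different → different)

-- Parts avoiding a shared palette

module _ {sizes : List ℕ} (c : V (CompleteMultipartite sizes) → ℕ)
         (proper : ∀ u v → proj₁ u ≢ proj₁ v → c u ≢ c v) (Z : List ℕ) where

  private
    Meets : Fin (length sizes) → Set
    Meets q = ∃ λ u → c (q , u) ∈ Z

    meets? : ∀ q → Dec (Meets q)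
    meets? q = any? (λ u → c (q , u) ∈? Z)

    tag : ∀ {q} → Dec (Meets q) → Fin (suc (length Z))
    tag (yes (_ , c∈Z)) = Fin.suc (index c∈Z)
    tag (no _)          = 0F

    collide : ∀ {q q'} → q ≢ q' → (d : Dec (Meets q)) (d' : Dec (Meets q')) → tag d ≡ tag d' →
              (∀ u → c (q , u) ∉ Z) × (∀ u → c (q' , u) ∉ Z)
    collide _ (no avoids) (no avoids') _ = (λ u c∈Z → avoids (u , c∈Z)) , (λ u c∈Z → avoids' (u , c∈Z))
    collide _ (yes _) (no _) ()
    collide _ (no _) (yes _) ()
    collide q≢q' (yes (u , c∈Z)) (yes (u' , c∈Z')) same-index =
      contradiction (trans (lookup-index c∈Z) (trans (cong (lookup Z) (suc-injective same-index))
                                                     (sym (lookup-index c∈Z'))))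
                    (proper (_ , u) (_ , u') q≢q')

  avoiding-parts : suc (length Z) < length sizes →
                   ∃₂ λ q q' → q ≢ q' × (∀ u → c (q , u) ∉ Z) × (∀ u → c (q' , u) ∉ Z)
  avoiding-parts bound with pigeonhole bound (tag ∘ meets?)
  ... | q , q' , q<q' , same-tag = q , q' , q≢q' , collide q≢q' (meets? q) (meets? q') same-tag
    where q≢q' = Finₚ.<⇒≢ q<q'

-- Transversals of families of colour pairs

_∈ₚ_ : ℕ → ℕ × ℕ → Set
x ∈ₚ xy = x ≡ proj₁ xy ⊎ x ≡ proj₂ xy

Transversal : (I → ℕ × ℕ) → (I → ℕ) → Set
Transversal P t = ∀ i → t i ∈ₚ P i

TransversalsMeet : (I → ℕ × ℕ) → (J → ℕ × ℕ) → Set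
TransversalsMeet P Q = ∀ {t s} → Transversal P t → Transversal Q s → ∃₂ λ i j → t i ≡ s j

_⊑_ : (I → ℕ × ℕ) → (J → ℕ × ℕ) → Set
P ⊑ Q = ∀ i → ∃ λ j → Q j ≡ P i

meet-sym : {P : I → ℕ × ℕ} {Q : J → ℕ × ℕ} → TransversalsMeet P Q → TransversalsMeet Q P
meet-sym meet tQ tP with meet tP tQ
... | i , j , same = j , i , sym same

transversal-⊑ : {P : I → ℕ × ℕ} {Q : J → ℕ × ℕ} {t : J → ℕ} →
                (sub : P ⊑ Q) → Transversal Q t → Transversal P (t ∘ proj₁ ∘ sub)
transversal-⊑ {t = t} sub tQ i = subst (t (proj₁ (sub i)) ∈ₚ_) (proj₂ (sub i)) (tQ (proj₁ (sub i)))

meet-monoˡ : {P : K → ℕ × ℕ} {P' : I → ℕ × ℕ} {Q : J → ℕ × ℕ} →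
             P ⊑ P' → TransversalsMeet P Q → TransversalsMeet P' Q
meet-monoˡ sub meet tP' tQ with meet (transversal-⊑ sub tP') tQ
... | i , j , same = proj₁ (sub i) , j , same

meet-monoʳ : {P : I → ℕ × ℕ} {Q : K → ℕ × ℕ} {Q' : J → ℕ × ℕ} →
             Q ⊑ Q' → TransversalsMeet P Q → TransversalsMeet P Q'
meet-monoʳ sub = meet-sym ∘ meet-monoˡ sub ∘ meet-sym

meet-at : {Q : J → ℕ × ℕ} {s : J → ℕ} → Transversal Q s → {t : I → ℕ} →
          ∀ i i' j → t i ≡ proj₁ (Q j) → t i' ≡ proj₂ (Q j) → ∃₂ λ i j → t i ≡ s j
meet-at tQ i i' j tᵢ tᵢ' with tQ j
... | inj₁ sⱼ = i  , j , trans tᵢ  (sym sⱼ)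
... | inj₂ sⱼ = i' , j , trans tᵢ' (sym sⱼ)

allPairs : Fin 6 → ℕ × ℕ
allPairs 0F = 0 , 1
allPairs 1F = 0 , 2
allPairs 2F = 0 , 3
allPairs 3F = 1 , 2
allPairs 4F = 1 , 3
allPairs 5F = 2 , 3

matching : Fin 2 → ℕ × ℕ
matching 0F = 0 , 1
matching 1F = 2 , 3

crossing : Fin 4 → ℕ × ℕ
crossing 0F = 0 , 2
crossing 1F = 0 , 3
crossing 2F = 1 , 2
crossing 3F = 1 , 3

matching⊑allPairs : matching ⊑ allPairs
matching⊑allPairs 0F = 0F , refl
matching⊑allPairs 1F = 5F , refl

crossing⊑allPairs : crossing ⊑ allPairs
crossing⊑allPairs 0F = 1F , refl
crossing⊑allPairs 1F = 2F , refl
crossing⊑allPairs 2F = 3F , refl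
crossing⊑allPairs 3F = 4F , refl

meet-matching-crossing : TransversalsMeet matching crossing
meet-matching-crossing {t} tP tQ with tP 0F | tP 1F
... | inj₁ t₀ | inj₁ t₁ = meet-at tQ {t} 0F 1F 0F t₀ t₁
... | inj₁ t₀ | inj₂ t₁ = meet-at tQ {t} 0F 1F 1F t₀ t₁
... | inj₂ t₀ | inj₁ t₁ = meet-at tQ {t} 0F 1F 2F t₀ t₁
... | inj₂ t₀ | inj₂ t₁ = meet-at tQ {t} 0F 1F 3F t₀ t₁

meet-crossing-allPairs : TransversalsMeet crossing allPairs
meet-crossing-allPairs {t} tP tQ with tP 0F | tP 3F
... | inj₁ t₀ | inj₁ t₃ = meet-at tQ {t} 0F 3F 0F t₀ t₃
... | inj₁ t₀ | inj₂ t₃ = meet-at tQ {t} 0F 3F 2F t₀ t₃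
... | inj₂ t₀ | inj₁ t₃ = meet-at tQ {t} 3F 0F 3F t₃ t₀
... | inj₂ t₀ | inj₂ t₃ = meet-at tQ {t} 0F 3F 5F t₀ t₃

meet-matching-allPairs : TransversalsMeet matching allPairs
meet-matching-allPairs = meet-monoʳ crossing⊑allPairs meet-matching-crossing

meet-allPairs-allPairs : TransversalsMeet allPairs allPairs
meet-allPairs-allPairs = meet-monoˡ matching⊑allPairs meet-matching-allPairs

partSizes : ℕ → List ℕ
partSizes m = 2 ∷ 4 ∷ replicate m 6

K₂₄₆ : ℕ → Graph
K₂₄₆ m = CompleteMultipartite (partSizes m)

partPairs : ∀ m (q : Fin (length (partSizes m))) → Fin (lookup (partSizes m) q) → ℕ × ℕ
partPairs m 0F                    = matching
partPairs m 1F                    = crossing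
partPairs m (Fin.suc (Fin.suc j)) = allPairs ∘ cast (lookup-replicate′ m 6 j)

allPairs⊑sixPart : ∀ m j → allPairs ⊑ partPairs m (Fin.suc (Fin.suc j))
allPairs⊑sixPart m j i = cast (sym e) i , cong allPairs (cast-involutive e (sym e) i)
  where e = lookup-replicate′ m 6 j

partPairs⊑allPairs : ∀ m q → partPairs m q ⊑ allPairs
partPairs⊑allPairs m 0F                    = matching⊑allPairs
partPairs⊑allPairs m 1F                    = crossing⊑allPairs
partPairs⊑allPairs m (Fin.suc (Fin.suc j)) u = cast (lookup-replicate′ m 6 j) u , refl

parts-meet : ∀ m {q q'} → q ≢ q' → TransversalsMeet (partPairs m q) (partPairs m q')
parts-meet m {0F} {0F} q≢q' = contradiction refl q≢q'
parts-meet m {0F} {1F} _ = meet-matching-crossing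
parts-meet m {0F} {Fin.suc (Fin.suc j)} _ =
  meet-monoʳ (allPairs⊑sixPart m j) meet-matching-allPairs
parts-meet m {1F} {0F} _ = meet-sym meet-matching-crossing
parts-meet m {1F} {1F} q≢q' = contradiction refl q≢q'
parts-meet m {1F} {Fin.suc (Fin.suc j)} _ =
  meet-monoʳ (allPairs⊑sixPart m j) meet-crossing-allPairs
parts-meet m {Fin.suc (Fin.suc i)} {0F} _ =
  meet-monoˡ (allPairs⊑sixPart m i) (meet-sym meet-matching-allPairs)
parts-meet m {Fin.suc (Fin.suc i)} {1F} _ =
  meet-monoˡ (allPairs⊑sixPart m i) (meet-sym meet-crossing-allPairs)
parts-meet m {Fin.suc (Fin.suc i)} {Fin.suc (Fin.suc j)} _ =
  meet-monoˡ (allPairs⊑sixPart m i) (meet-monoʳ (allPairs⊑sixPart m j) meet-allPairs-allPairs)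

pairList : ∀ m → List ℕ → ListAssignment (K₂₄₆ m)
pairList m Z (q , u) = proj₁ (partPairs m q u) ∷ proj₂ (partPairs m q u) ∷ Z

∈-pair-or : ∀ {x a b Z} → x ∈ a ∷ b ∷ Z → x ∉ Z → x ∈ₚ (a , b)
∈-pair-or (here x≡a)         _   = inj₁ x≡a
∈-pair-or (there (here x≡b)) _   = inj₂ x≡b
∈-pair-or (there (there x∈Z)) x∉Z = contradiction x∈Z x∉Z

avoiding⇒transversal : ∀ {m Z} {c : V (K₂₄₆ m) → ℕ} → (∀ v → c v ∈ pairList m Z v) →
                        ∀ {q} → (∀ u → c (q , u) ∉ Z) → Transversal (partPairs m q) (λ u → c (q , u))
avoiding⇒transversal c∈L {q} avoids u = ∈-pair-or (c∈L (q , u)) (avoids u)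

pairList-uncolourable : ∀ m Z → length Z ≤ m → ¬ LColorable (K₂₄₆ m) (pairList m Z)
pairList-uncolourable m Z |Z|≤m (c , c∈L , proper)
  with avoiding-parts c proper Z (s≤s (s≤s (≤-trans |Z|≤m (≤-reflexive (sym (length-replicate m))))))
... | q , q' , q≢q' , q-avoids , q'-avoids
  with parts-meet m q≢q' (avoiding⇒transversal c∈L q-avoids) (avoiding⇒transversal c∈L q'-avoids)
... | u , u' , same = proper (q , u) (q' , u') q≢q' same

SmallPair : ℕ × ℕ → Set
SmallPair xy = proj₁ xy < 4 × proj₂ xy < 4 × proj₁ xy ≢ proj₂ xy

small? : ∀ xy → Dec (SmallPair xy)
small? xy = (proj₁ xy <? 4) ×-dec ((proj₂ xy <? 4) ×-dec ¬? (proj₁ xy ≟ proj₂ xy))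

allPairs-small : ∀ i → SmallPair (allPairs i)
allPairs-small = from-yes (all? (small? ∘ allPairs))

partPairs-small : ∀ m q u → SmallPair (partPairs m q u)
partPairs-small m q u with partPairs⊑allPairs m q u
... | i , same = subst SmallPair same (allPairs-small i)

palette : List A → List ℕ
palette E = tabulate {n = length E} (λ i → 4 + toℕ i)

lookupOr : A → List A → ℕ → A
lookupOr d []       _       = d
lookupOr d (x ∷ xs) zero    = x
lookupOr d (x ∷ xs) (suc r) = lookupOr d xs r

tabulate-lookupOr : ∀ (d : A) xs → tabulate {n = length xs} (λ i → lookupOr d xs (toℕ i)) ≡ xs
tabulate-lookupOr d []       = refl
tabulate-lookupOr d (x ∷ xs) = cong (x ∷_) (tabulate-lookupOr d xs)

-- Colour 4 + r of the palette lies in class E[r]; all other colours, in particular those of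
-- the pairs, lie in class p.
paletteClass : Fin t → List (Fin t) → ℕ → Fin t
paletteClass p E (suc (suc (suc (suc r)))) = lookupOr p E r
paletteClass p E _                         = p

paletteClass-small : ∀ (p : Fin t) E {x} → x < 4 → paletteClass p E x ≡ p
paletteClass-small p E {0} _ = refl
paletteClass-small p E {1} _ = refl
paletteClass-small p E {2} _ = refl
paletteClass-small p E {3} _ = refl
paletteClass-small p E {suc (suc (suc (suc _)))} (s≤s (s≤s (s≤s (s≤s ()))))

map-paletteClass : ∀ (p : Fin t) E → map (paletteClass p E) (palette E) ≡ E
map-paletteClass p E = trans (map-tabulate (λ i → 4 + toℕ i) (paletteClass p E)) (tabulate-lookupOr p E)

small∉palette : ∀ {x} (E : List A) → x < 4 → All (x ≢_) (palette E)
small∉palette E x<4 = All.tabulate⁺ λ i → <⇒≢ (<-≤-trans x<4 (m≤m+n 4 (toℕ i)))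

palette-unique : ∀ (E : List A) → Unique (palette E)
palette-unique E = Unique.tabulate⁺ λ same → toℕ-injective (+-cancelˡ-≡ 4 _ _ same)

pairList-isλ : ∀ {m k} ls (p : Fin (length ls)) E → 2 + length E ≡ k →
               (∀ i → count i (p ∷ p ∷ E) ≡ lookup ls i) →
               IsLambdaAssignment (K₂₄₆ m) k ls (pairList m (palette E))
pairList-isλ {m} ls p E len counts = (λ v → unique v , size) , paletteClass p E , class-counts
  where
  L = pairList m (palette E)
  unique : ∀ v → Unique (L v)
  unique (q , u) with partPairs-small m q u
  ... | x<4 , y<4 , x≢y = (x≢y ∷ small∉palette E x<4) ∷ small∉palette E y<4 ∷ palette-unique E
  size : 2 + length (palette E) ≡ _
  size = trans (cong (2 +_) (length-tabulate _)) len
  classes : ∀ v → map (paletteClass p E) (L v) ≡ p ∷ p ∷ E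
  classes (q , u) with partPairs-small m q u
  ... | x<4 , y<4 , _ = cong₂ _∷_ (paletteClass-small p E x<4)
                                  (cong₂ _∷_ (paletteClass-small p E y<4) (map-paletteClass p E))
  class-counts : ∀ v i → length (filter (λ x → paletteClass p E x Fin.≟ i) (L v)) ≡ lookup ls i
  class-counts v i = begin
    length (filter (λ x → paletteClass p E x Fin.≟ i) (L v))
      ≡⟨ sym (length-filter-map (Fin._≟ i) (paletteClass p E) (L v)) ⟩
    count i (map (paletteClass p E) (L v))
      ≡⟨ cong (count i) (classes v) ⟩
    count i (p ∷ p ∷ E)
      ≡⟨ counts i ⟩
    lookup ls i ∎
    where open ≡-Reasoning

not-choosable : ∀ k ls → IsPartition k ls → ¬ (ls ↭ replicate k 1) →
                ¬ LambdaChoosable (K₂₄₆ (k ∸ 2)) k ls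
not-choosable k ls (pos , sum≡k) ≉ones choosable with partition-part≥2 (pos , sum≡k) ≉ones
... | p , 2≤λₚ with ↭-replicate++ 2 (blocks ls) (subst (2 ≤_) (sym (count-blocks ls p)) 2≤λₚ)
... | E , blocks↭ =
  pairList-uncolourable (k ∸ 2) (palette E) (≤-reflexive |palette|)
    (choosable (pairList (k ∸ 2) (palette E)) (pairList-isλ ls p E len counts))
  where
  len : 2 + length E ≡ k
  len = trans (sym (↭-length blocks↭)) (trans (length-blocks ls) sum≡k)
  counts : ∀ i → count i (p ∷ p ∷ E) ≡ lookup ls i
  counts i = trans (sym (count-↭ blocks↭)) (count-blocks ls i)
  |palette| : length (palette E) ≡ k ∸ 2
  |palette| = trans (length-tabulate _) (cong (_∸ 2) len)

length-partSizes : ∀ {k} → 2 ≤ k → length (partSizes (k ∸ 2)) ≡ k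
length-partSizes {k} 2≤k = trans (cong (2 +_) (length-replicate (k ∸ 2))) (m+[n∸m]≡n 2≤k)

mainTheorem3 : ∀ (k : ℕ) → 3 ≤ k →
    StrictlyColorable k (CompleteMultipartite (2 ∷ 4 ∷ replicate (k ∸ 2) 6))
mainTheorem3 k 3≤k = ones-choosable , not-choosable k
  where
  ones-choosable : LambdaChoosable (K₂₄₆ (k ∸ 2)) k (replicate k 1)
  ones-choosable = subst (λ n → LambdaChoosable (K₂₄₆ (k ∸ 2)) n (replicate n 1))
                         (length-partSizes (≤-trans (n≤1+n 2) 3≤k))
                         (multipartite-ones-choosable (partSizes (k ∸ 2)))
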